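{- Let $g\ge1$, $n\ge0$ with $3g-3+n>0$, and let $\Phi\in\operatorname{Aut}(\Delta_{g,n})$. Then $\Phi[\mathbf R^1_{g,n}]=[\mathbf R^1_{g,n}]$.
   Context: $I_n=\{1,\dots,n\}$; $[p]=\{0,\dots,p\}$, $[-1]=\emptyset$. A graph $G$ is a finite set $X(G)=V(G)\sqcup H(G)$ with maps $s,r$ ($s^2=\mathrm{id}$, $r^2=r$, both with fixed-point set $V(G)$); $r$ gives the vertex of a half-edge, edges are $s$-orbits in $H(G)$ (loops, multiple edges allowed); graphs are connected, $b^1(G)=|E|-|V|+1$, $\mathrm{val}(v)$ = number of half-edges at $v$. A stable $n$-marked weighted graph of genus $g$ is $\mathbf G=(G,w,m)$, $w:V\to\mathbb Z_{\ge0}$, $m:I_n\to V$, with $b^1(G)+\sum w(v)=g$ and $2w(v)-2+\mathrm{val}(v)+|m^{ -1}(v)|>0$ for all $v$; isomorphisms preserve $r,s,w,m$. Contracting a loop deletes it and adds 1 to its vertex weight; contracting a non-loop edge merges its endpoints (weights summed, markings united). An edge-labelled pair $(\mathbf G,\tau)$ has $\tau:E(\mathbf G)\to[p]$ a bijection; pairs are isomorphic if an isomorphism respects labels; $[\mathbf G,\tau]$ is the class. $\Delta_{g,n}$ is the contravariant functor on the category $\mathrm I$ (objects $[p]$, $p\ge-1$; morphisms injections) with $\Delta_{g,n}[p]=\{[\mathbf G,\tau]:|E(\mathbf G)|=p+1\}$ and, for injective $\iota:[p]\to[q]$, $\Delta_{g,n}(\iota)[\mathbf G,\tau]$ obtained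 by contracting edges with labels outside $\iota([p])$ and relabelling remaining edges by $\iota^{ -1}\circ\tau$; $\operatorname{Aut}$ means natural automorphisms. $\mathbf R^1_{g,n}$ is the graph with one vertex of weight $g-1$, one loop, and all $n$ markings on that vertex; $[\mathbf R^1_{g,n}]\in\Delta_{g,n}[0]$ is its unique class (a vertex of $\Delta_{g,n}$). -}

module Defs where

open import Data.Nat using (ℕ; zero; suc; pred; _+_; _*_; _<_; _≤_; z≤n; s≤s)
open import Data.Nat.Properties using (≤-trans; m≤m+n; m≤n+m; +-suc; +-comm)
open import Relation.Binary.PropositionalEquality using (sym)
open import Data.Fin using (Fin; zero; suc)
open import Data.Fin.Properties using (_≟_; any?)
open import Data.Bool using (Bool; true; false; not)
open import Data.Product using (Σ; ∃; _,_; _×_)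
open import Data.Sum using (_⊎_)
open import Data.Unit using (⊤; tt)
open import Relation.Nullary using (Dec; yes; no; ¬_; ¬?)
open import Relation.Binary.PropositionalEquality using (_≡_; refl; cong)
open import Function.Bundles using (_↔_; Inverse)
open import Function.Definitions using (Injective)

sumFin : ∀ {k} → (Fin k → ℕ) → ℕ
sumFin {zero}  f = 0
sumFin {suc k} f = f zero + sumFin (λ i → f (suc i))

χ : ∀ {P : Set} → Dec P → ℕ
χ (yes _) = 1
χ (no _)  = 0

-- Edge-labelled n-marked weighted graphs with k = p+1 edges.
-- Edge labels are Fin k = [p].  The half-edges are the pairs (e , b),
-- e : Fin k, b : Bool; the involution s is (e , b) ↦ (e , not b) and
-- r (e , b) = end e b is the vertex carrying the half-edge.

record WGraph (n k : ℕ) : Set where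
  field
    nv  : ℕ
    w   : Fin nv → ℕ
    m   : Fin n → Fin nv
    end : Fin k → Bool → Fin nv

open WGraph public

data Reach {nv k : ℕ} (end' : Fin k → Bool → Fin nv) (allowed : Fin k → Set)
     : Fin nv → Fin nv → Set where
  here : ∀ {x} → Reach end' allowed x x
  step : ∀ {x y} (e : Fin k) (b : Bool) → allowed e → end' e b ≡ x →
         Reach end' allowed (end' e (not b)) y → Reach end' allowed x y

module _ {n k : ℕ} (G : WGraph n k) where
  val : Fin (nv G) → ℕ
  val v = sumFin (λ e → χ (end G e false ≟ v) + χ (end G e true ≟ v))

  marks : Fin (nv G) → ℕ
  marks v = sumFin (λ j → χ (m G j ≟ v))

  Connected : Set
  Connected = (0 < nv G) × (∀ x y → Reach (end G) (λ _ → ⊤) x y)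

  -- b¹(G) + Σ w(v) = g  with b¹ = |E| - |V| + 1, written without subtraction
  HasGenus : ℕ → Set
  HasGenus g = k + 1 + sumFin (w G) ≡ g + nv G

  Stable : Set
  Stable = ∀ v → 2 < 2 * w G v + val v + marks v

record SGraph (g n k : ℕ) : Set where
  field
    graph     : WGraph n k
    connected : Connected graph
    genus     : HasGenus graph g
    stable    : Stable graph

open SGraph public

-- Isomorphism of edge-labelled pairs: a bijection of vertices preserving
-- weights and markings, and for each edge (with the same label) a
-- bijection of its two half-edges compatible with r.

record _≅_ {g n k : ℕ} (G H : SGraph g n k) : Set where
  private
    G' = graph G
    H' = graph H
  field
    σ      : Fin (nv G') ↔ Fin (nv H')
  open Inverse σ using (to)
  field
    w-pres : ∀ x → w H' (to x) ≡ w G' x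
    m-pres : ∀ j → m H' j ≡ to (m G' j)
    e-pres : ∀ e → (∀ b → end H' e b ≡ to (end G' e b))
                 ⊎ (∀ b → end H' e b ≡ to (end G' e (not b)))

-- Δ_{g,n}(ι): G' is (a representative of) the graph obtained from G by
-- contracting all edges whose label is not in the image of ι and
-- relabelling the remaining edges by ι⁻¹ ∘ τ.  Concretely: a surjection
-- π from old vertices to new vertices whose fibres are the connected
-- components of the subgraph of contracted edges; each new vertex gets
-- weight  Σ(weights in fibre) + b¹(fibre subgraph), markings are pushed
-- forward, and edge i of G' is edge ι i of G.

Contracted : ∀ {k l} → (Fin k → Fin l) → Fin l → Set
Contracted ι e = ¬ (∃ λ i → ι i ≡ e)

contracted? : ∀ {k l} (ι : Fin k → Fin l) (e : Fin l) → Dec (Contracted ι e)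
contracted? ι e = ¬? (any? (λ i → ι i ≟ e))

record IsContraction {g n k l : ℕ} (ι : Fin k → Fin l)
       (G : SGraph g n l) (G' : SGraph g n k) : Set where
  private
    A = graph G
    B = graph G'
  field
    π        : Fin (nv A) → Fin (nv B)
    π-surj   : ∀ u → ∃ λ x → π x ≡ u
    π-edges  : ∀ i b → end B i b ≡ π (end A (ι i) b)
    π-contr  : ∀ e → Contracted ι e → π (end A e false) ≡ π (end A e true)
    π-fibres : ∀ x y → π x ≡ π y → Reach (end A) (Contracted ι) x y
    π-marks  : ∀ j → m B j ≡ π (m A j)
    π-weight : ∀ u →
      w B u + sumFin (λ x → χ (π x ≟ u))
        ≡ sumFin (λ x → χ (π x ≟ u) * w A x)
          + sumFin (λ e → χ (contracted? ι e) * χ (π (end A e false) ≟ u))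
          + 1

-- Natural automorphisms of Δ_{g,n} (components on all objects [p],
-- p ≥ -1, i.e. k = p+1 ≥ 0 edges), acting on representatives and
-- well-defined / bijective on isomorphism classes.

record NatAut (g n : ℕ) : Set where
  field
    Φ       : ∀ k → SGraph g n k → SGraph g n k
    resp    : ∀ k (G H : SGraph g n k) → G ≅ H → Φ k G ≅ Φ k H
    inj     : ∀ k (G H : SGraph g n k) → Φ k G ≅ Φ k H → G ≅ H
    surj    : ∀ k (H : SGraph g n k) → ∃ λ G → Φ k G ≅ H
    natural : ∀ k l (ι : Fin k → Fin l) → Injective _≡_ _≡_ ι →
              ∀ (G : SGraph g n l) (G' : SGraph g n k) (H : SGraph g n k) →
              IsContraction ι G G' → IsContraction ι (Φ l G) H → H ≅ Φ k G'

R1graph : (g n : ℕ) → WGraph n 1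
R1graph g n = record
  { nv = 1 ; w = λ _ → pred g ; m = λ _ → zero ; end = λ _ _ → zero }

private
  R1-stable : ∀ g' n → 3 < 3 * suc g' + n → Stable (R1graph (suc g') n)
  R1-stable zero    zero    (s≤s (s≤s (s≤s ())))
  R1-stable zero    (suc n) _ zero = s≤s (s≤s (s≤s z≤n))
  R1-stable (suc g') n      _ zero =
    ≤-trans (s≤s (m≤n+m 2 (g' + suc (g' + 0)))) (m≤m+n _ (marks (R1graph (suc (suc g')) n) zero))

R1 : (g n : ℕ) → 1 ≤ g → 3 < 3 * g + n → SGraph g n 1
R1 (suc g') n _ h = record
  { graph     = R1graph (suc g') n
  ; connected = s≤s z≤n , (λ { zero zero → here })
  ; genus     = cong suc (sym (+-suc g' 0))
  ; stable    = R1-stable g' n h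
  }

module Submission where

-- Let g = h + 1 and Y = Φ(R¹), a stable graph with a single edge.  If that
-- edge is a loop, connectedness leaves Y a single vertex, of weight h by
-- the genus formula, so Y ≅ R¹.  To exclude that the edge of Y joins two
-- distinct vertices we use the necklace K: a cycle on n + h vertices carrying
-- the n markings and h further loops.  It is stable of genus g, has n + 2h
-- edges, and no edge separates it.  Let X = Φ(K).  If the ends of some edge
-- e of X were joined avoiding e, then contracting every edge but e in K and
-- in X would give R¹ in both cases, and naturality of Φ would give
-- R¹ ≅ Φ(R¹) = Y, so the edge of Y would be a loop.  Hence every edge of X
-- is a bridge and X, being connected, has more than n + 2h vertices; but
-- summing the stability inequalities bounds the vertices of any stable graph
-- of genus g by 2g - 2 + n = n + 2h.  (Constructively the case split is made
-- under a double negation, harmless since the conclusion is decidable.)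

open import Defs
open import Data.Bool using (Bool; true; false; not)
open import Data.Bool.Properties using (not-involutive)
open import Data.Empty using (⊥; ⊥-elim)
open import Data.Fin as F
  using (Fin; zero; suc; toℕ; inject₁; fromℕ; fromℕ<; cast; punchOut; splitAt; _↑ˡ_; _↑ʳ_)
open import Data.Fin.Induction using (<-weakInduction; >-weakInduction)
open import Data.Fin.Properties as FP
  using (_≟_; punchOut-injective; injective⇒≤; toℕ-inject₁; ≤fromℕ; ↑ˡ-injective;
         splitAt-↑ˡ; splitAt-↑ʳ; splitAt⁻¹-↑ˡ; splitAt⁻¹-↑ʳ; cast-involutive)
open import Data.Nat using (ℕ; zero; suc; _+_; _*_; _<_; _≤_; _<?_; z≤n; s≤s)
open import Data.Nat.Properties
  using (+-0-commutativeMonoid; +-comm; +-assoc; +-identityʳ; *-zeroʳ; *-identityˡ;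
         *-identityʳ; *-distribˡ-+; ≤-refl; ≤-reflexive; ≤-trans; <-irrefl; <⇒≤; <⇒≱;
         m≤m+n; m≤n+m; +-mono-≤; +-monoˡ-≤; +-monoʳ-≤; +-cancelˡ-≤; +-cancelʳ-≤;
         +-cancelˡ-≡; suc-injective; module ≤-Reasoning)
open import Data.Nat.Tactic.RingSolver using (solve-∀)
open import Data.Product using (Σ; _,_; _×_; proj₁; proj₂)
open import Data.Sum using (_⊎_; inj₁; inj₂; [_,_]′)
open import Data.Unit using (⊤; tt)
open import Function.Bundles using (mk↔ₛ′)
open import Function.Definitions using (Injective)
open import Relation.Binary.PropositionalEquality
open import Relation.Nullary using (Dec; yes; no; ¬_)
open import Relation.Nullary.Decidable using (decidable-stable; ¬¬-excluded-middle)
open import Algebra.Properties.CommutativeMonoid.Sum +-0-commutativeMonoid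
  using (sum; sum-cong-≗; ∑-distrib-+; ∑-comm)

χ-yes : ∀ {P : Set} → P → (d : Dec P) → χ d ≡ 1
χ-yes p (yes _) = refl
χ-yes p (no ¬p) = ⊥-elim (¬p p)

χ-no : ∀ {P : Set} → ¬ P → (d : Dec P) → χ d ≡ 0
χ-no ¬p (yes p) = ⊥-elim (¬p p)
χ-no ¬p (no _)  = refl

-- sumFin is the library's finite sum in the monoid (ℕ, +, 0); this lets us
-- reuse its distributivity and interchange laws.
sumFin≡sum : ∀ {k} (f : Fin k → ℕ) → sumFin f ≡ sum f
sumFin≡sum {zero}  f = refl
sumFin≡sum {suc k} f = cong (f zero +_) (sumFin≡sum (λ i → f (suc i)))

sumFin-cong : ∀ {k} {f g : Fin k → ℕ} → (∀ i → f i ≡ g i) → sumFin f ≡ sumFin g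
sumFin-cong {zero}  f≗g = refl
sumFin-cong {suc k} f≗g = cong₂ _+_ (f≗g zero) (sumFin-cong (λ i → f≗g (suc i)))

sumFin-+ : ∀ {k} (f g : Fin k → ℕ) → sumFin (λ i → f i + g i) ≡ sumFin f + sumFin g
sumFin-+ f g = begin
  sumFin (λ i → f i + g i) ≡⟨ sumFin≡sum (λ i → f i + g i) ⟩
  sum (λ i → f i + g i)    ≡⟨ ∑-distrib-+ f g ⟩
  sum f + sum g            ≡⟨ sym (cong₂ _+_ (sumFin≡sum f) (sumFin≡sum g)) ⟩
  sumFin f + sumFin g      ∎
  where open ≡-Reasoning

sumFin-swap : ∀ {a b} (F : Fin a → Fin b → ℕ) →
  sumFin (λ i → sumFin (F i)) ≡ sumFin (λ j → sumFin (λ i → F i j))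
sumFin-swap F = begin
  sumFin (λ i → sumFin (F i))         ≡⟨ sumFin≡sum (λ i → sumFin (F i)) ⟩
  sum (λ i → sumFin (F i))            ≡⟨ sum-cong-≗ (λ i → sumFin≡sum (F i)) ⟩
  sum (λ i → sum (F i))               ≡⟨ ∑-comm F ⟩
  sum (λ j → sum (λ i → F i j))       ≡⟨ sum-cong-≗ (λ j → sumFin≡sum (λ i → F i j)) ⟨
  sum (λ j → sumFin (λ i → F i j))    ≡⟨ sumFin≡sum (λ j → sumFin (λ i → F i j)) ⟨
  sumFin (λ j → sumFin (λ i → F i j)) ∎
  where open ≡-Reasoning

sumFin-const : ∀ k c → sumFin {k} (λ _ → c) ≡ k * c
sumFin-const zero    c = refl
sumFin-const (suc k) c = cong (c +_) (sumFin-const k c)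

sumFin-scale : ∀ {k} c (f : Fin k → ℕ) → sumFin (λ i → c * f i) ≡ c * sumFin f
sumFin-scale {zero}  c f = sym (*-zeroʳ c)
sumFin-scale {suc k} c f =
  trans (cong (c * f zero +_) (sumFin-scale c (λ i → f (suc i))))
        (sym (*-distribˡ-+ c (f zero) _))

sumFin-δ : ∀ {k} (a : Fin k) → sumFin (λ v → χ (a ≟ v)) ≡ 1
sumFin-δ {suc k} zero    = cong suc (trans (sumFin-const k 0) (*-zeroʳ k))
sumFin-δ {suc k} (suc a) = trans (sumFin-cong δ-suc) (sumFin-δ a)
  where
  δ-suc : ∀ i → χ (suc a ≟ suc i) ≡ χ (a ≟ i)
  δ-suc i with a ≟ i
  ... | yes _ = refl
  ... | no _  = refl

sumFin-mono : ∀ {k} {f g : Fin k → ℕ} → (∀ i → f i ≤ g i) → sumFin f ≤ sumFin g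
sumFin-mono {zero}  f≤g = z≤n
sumFin-mono {suc k} f≤g = +-mono-≤ (f≤g zero) (sumFin-mono (λ i → f≤g (suc i)))

term≤sumFin : ∀ {k} (f : Fin k → ℕ) i → f i ≤ sumFin f
term≤sumFin f zero    = m≤m+n _ _
term≤sumFin f (suc i) = ≤-trans (term≤sumFin (λ j → f (suc j)) i) (m≤n+m _ (f zero))

terms≤sumFin : ∀ {k} (f : Fin k → ℕ) i j → ¬ i ≡ j → f i + f j ≤ sumFin f
terms≤sumFin f zero    zero    i≢j = ⊥-elim (i≢j refl)
terms≤sumFin f zero    (suc j) i≢j = +-monoʳ-≤ (f zero) (term≤sumFin (λ x → f (suc x)) j)
terms≤sumFin f (suc i) zero    i≢j = subst (_≤ sumFin f) (+-comm (f zero) (f (suc i)))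
  (+-monoʳ-≤ (f zero) (term≤sumFin (λ x → f (suc x)) i))
terms≤sumFin f (suc i) (suc j) i≢j =
  ≤-trans (terms≤sumFin (λ x → f (suc x)) i j (λ i≡j → i≢j (cong suc i≡j))) (m≤n+m _ (f zero))

Avoiding : ∀ {nv k} → (Fin k → Bool → Fin nv) → Fin k → Fin nv → Fin nv → Set
Avoiding E e = Reach E (λ d → ¬ d ≡ e)

Bridge : ∀ {nv k} → (Fin k → Bool → Fin nv) → Fin k → Set
Bridge E e = ¬ Avoiding E e (E e false) (E e true)

module _ {nv k : ℕ} {E : Fin k → Bool → Fin nv} where

  reach-trans : ∀ {P x y z} → Reach E P x y → Reach E P y z → Reach E P x z
  reach-trans here                q = q
  reach-trans (step e b p refl r) q = step e b p refl (reach-trans r q)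

  cross : ∀ {P x x' y} e b → P e → E e b ≡ x → E e (not b) ≡ x' →
          Reach E P x' y → Reach E P x y
  cross e b p refl refl r = step e b p refl r

  reach-rev : ∀ {P x y} → Reach E P x y → Reach E P y x
  reach-rev here                = here
  reach-rev (step e b p refl r) =
    reach-trans (reach-rev r) (cross e (not b) p refl (cong (E e) (not-involutive b)) here)

  reach-mono : ∀ {P Q : Fin k → Set} {x y} → (∀ d → P d → Q d) →
               Reach E P x y → Reach E Q x y
  reach-mono P⇒Q here             = here
  reach-mono P⇒Q (step e b p q r) = step e b (P⇒Q e p) q (reach-mono P⇒Q r)

  bothEnds : ∀ {P x} e c → P e → Reach E P x (E e c) → ∀ b → Reach E P x (E e b)
  bothEnds e false p r false = r
  bothEnds e true  p r true  = r
  bothEnds e false p r true  = reach-trans r (cross e false p refl refl here)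
  bothEnds e true  p r false = reach-trans r (cross e true p refl refl here)

  firstUse : ∀ {P x y} e → Reach E P x y →
             Reach E (λ d → P d × ¬ d ≡ e) x y
             ⊎ Σ Bool (λ b → Reach E (λ d → P d × ¬ d ≡ e) x (E e b))
  firstUse e here = inj₁ here
  firstUse e (step d b p refl r) with d ≟ e | firstUse e r
  ... | yes refl | _             = inj₂ (b , here)
  ... | no d≢e   | inj₁ r'       = inj₁ (step d b (p , d≢e) refl r')
  ... | no d≢e   | inj₂ (c , r') = inj₂ (c , step d b (p , d≢e) refl r')

  reroute : ∀ {P x y} e → Avoiding E e (E e false) (E e true) →
            Reach E P x y → Avoiding E e x y
  reroute e joined here = here
  reroute e joined (step d b p refl r) with d ≟ e
  ... | no d≢e   = step d b d≢e refl (reroute e joined r)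
  ... | yes refl = reach-trans (across b) (reroute e joined r)
    where
    across : ∀ b → Avoiding E e (E e b) (E e (not b))
    across false = joined
    across true  = reach-rev joined

missingInjection⇒< : ∀ {k m} (f : Fin k → Fin m) (r : Fin m) →
                     (∀ e → ¬ r ≡ f e) → Injective _≡_ _≡_ f → k < m
missingInjection⇒< {m = suc m} f r r∉f f-inj =
  s≤s (injective⇒≤ {f = λ e → punchOut (r∉f e)}
        (λ same → f-inj (punchOut-injective (r∉f _) (r∉f _) same)))

-- Sending every edge of a connected graph whose edges are all bridges to its
-- end far from a root r is injective and misses r.  To choose the far end we
-- are given, for each edge, whether r reaches its end `false` avoiding it.
module FarEnds {nv k : ℕ} (E : Fin k → Bool → Fin nv)
  (conn : ∀ x y → Reach E (λ _ → ⊤) x y) (bridge : ∀ e → Bridge E e) (r : Fin nv)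
  (reaches? : ∀ e → Dec (Avoiding E e r (E e false))) where

  record IsFarEnd (e : Fin k) (x : Fin nv) : Set where
    field
      side   : Bool
      is-end : E e side ≡ x
      far    : ¬ Avoiding E e r x
      near   : Avoiding E e r (E e (not side))
  open IsFarEnd

  farEnd : Fin k → Fin nv
  farEnd e with reaches? e
  ... | yes _ = E e true
  ... | no _  = E e false

  farEnd-isFar : ∀ e → IsFarEnd e (farEnd e)
  farEnd-isFar e with reaches? e
  ... | yes r→0 = record
    { side = true ; is-end = refl ; near = r→0
    ; far  = λ r→1 → bridge e (reach-trans (reach-rev r→0) r→1) }
  ... | no ¬r→0 with firstUse e (conn r (E e false))
  ...   | inj₁ w           = ⊥-elim (¬r→0 (reach-mono (λ _ → proj₂) w))
  ...   | inj₂ (false , w) = ⊥-elim (¬r→0 (reach-mono (λ _ → proj₂) w))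
  ...   | inj₂ (true , w)  = record
    { side = false ; is-end = refl ; far = ¬r→0 ; near = reach-mono (λ _ → proj₂) w }

  root-not-far : ∀ e → ¬ r ≡ farEnd e
  root-not-far e r≡far = far (farEnd-isFar e) (subst (Avoiding E e r) r≡far here)

  -- If e ≠ e' had the same far end, the walk from r to the near end of e
  -- either avoids e' (and then reaches the far end of e' avoiding e') or
  -- meets e' first (and then reaches the far end of e avoiding e).
  farEnd-injective : Injective _≡_ _≡_ farEnd
  farEnd-injective {e} {e'} same with e ≟ e'
  ... | yes e≡e' = e≡e'
  ... | no e≢e'  = ⊥-elim (distinct (farEnd-isFar e) (farEnd-isFar e'))
    where
    distinct : IsFarEnd e (farEnd e) → IsFarEnd e' (farEnd e') → ⊥
    distinct F F' with firstUse e' (near F)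
    ... | inj₁ w       = far F' (subst (Avoiding E e' r) (trans (is-end F) same)
      (bothEnds e _ e≢e' (reach-mono (λ _ → proj₂) w) (side F)))
    ... | inj₂ (c , w) = far F (subst (Avoiding E e r) (trans (is-end F') (sym same))
      (bothEnds e' c (λ e'≡e → e≢e' (sym e'≡e)) (reach-mono (λ _ → proj₁) w) (side F')))

  edges<vertices : k < nv
  edges<vertices = missingInjection⇒< farEnd r root-not-far farEnd-injective

¬¬-decideAll : ∀ {m} (P : Fin m → Set) → ¬ ¬ (∀ i → Dec (P i))
¬¬-decideAll {zero}  P no-dec = no-dec (λ ())
¬¬-decideAll {suc m} P no-dec = ¬¬-excluded-middle λ d₀ →
  ¬¬-decideAll (λ i → P (suc i)) λ ds → no-dec λ { zero → d₀ ; (suc i) → ds i }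

-- A connected graph all of whose edges are bridges has more vertices than
-- edges (a forest has |V| = |E| + #components).
allBridges⇒edges<vertices : ∀ {nv k} (E : Fin k → Bool → Fin nv) →
  (∀ x y → Reach E (λ _ → ⊤) x y) → Fin nv → (∀ e → Bridge E e) → k < nv
allBridges⇒edges<vertices E conn r bridge = decidable-stable (_ <? _) λ ¬k<nv →
  ¬¬-decideAll (λ e → Avoiding E e r (E e false)) λ reaches? →
    ¬k<nv (FarEnds.edges<vertices E conn bridge r reaches?)

module _ {n k : ℕ} (G : WGraph n k) where

  handshake : sumFin (val G) ≡ k * 2
  handshake = begin
    sumFin (λ v → sumFin (λ e → χ (end G e false ≟ v) + χ (end G e true ≟ v)))
      ≡⟨ sumFin-swap (λ v e → χ (end G e false ≟ v) + χ (end G e true ≟ v)) ⟩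
    sumFin (λ e → sumFin (λ v → χ (end G e false ≟ v) + χ (end G e true ≟ v)))
      ≡⟨ sumFin-cong (λ e →
           trans (sumFin-+ (λ v → χ (end G e false ≟ v)) (λ v → χ (end G e true ≟ v)))
                 (cong₂ _+_ (sumFin-δ (end G e false)) (sumFin-δ (end G e true)))) ⟩
    sumFin {k} (λ _ → 2)
      ≡⟨ sumFin-const k 2 ⟩
    k * 2 ∎
    where open ≡-Reasoning

  markCount : sumFin (marks G) ≡ n
  markCount = begin
    sumFin (λ v → sumFin (λ j → χ (m G j ≟ v))) ≡⟨ sumFin-swap (λ v j → χ (m G j ≟ v)) ⟩
    sumFin (λ j → sumFin (λ v → χ (m G j ≟ v))) ≡⟨ sumFin-cong (λ j → sumFin-δ (m G j)) ⟩
    sumFin {n} (λ _ → 1)                        ≡⟨ sumFin-const n 1 ⟩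
    n * 1                                       ≡⟨ *-identityʳ n ⟩
    n ∎
    where open ≡-Reasoning

-- A stable graph of genus g with n markings has at most 2g - 2 + n vertices:
-- summing the stability inequalities gives 3|V| ≤ 2Σw + 2|E| + n, and the
-- genus formula turns the right-hand side into 2(g + |V| - 1) + n.
vertexBound : ∀ {g n k} (X : SGraph g n k) → nv (graph X) + 2 ≤ 2 * g + n
vertexBound {g} {n} {k} X = +-cancelˡ-≤ (2 * V) (V + 2) (2 * g + n) (begin
  2 * V + (V + 2)                       ≡⟨ arrange₁ V ⟩
  V * 3 + 2                             ≤⟨ +-monoˡ-≤ 2 summedStability ⟩
  2 * W + k * 2 + n + 2                 ≡⟨ arrange₂ W k n ⟩
  2 * (k + 1 + W) + n                   ≡⟨ cong (λ t → 2 * t + n) (genus X) ⟩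
  2 * (g + V) + n                       ≡⟨ arrange₃ g V n ⟩
  2 * V + (2 * g + n)                   ∎)
  where
  open ≤-Reasoning
  G : WGraph n k
  G = graph X
  V W : ℕ
  V = nv G
  W = sumFin (w G)

  summedStability : V * 3 ≤ 2 * W + k * 2 + n
  summedStability = begin
    V * 3                                           ≡⟨ sumFin-const V 3 ⟨
    sumFin {V} (λ _ → 3)                            ≤⟨ sumFin-mono (stable X) ⟩
    sumFin (λ v → 2 * w G v + val G v + marks G v)  ≡⟨ sumFin-+ _ (marks G) ⟩
    sumFin (λ v → 2 * w G v + val G v) + sumFin (marks G)
      ≡⟨ cong₂ _+_ (sumFin-+ (λ v → 2 * w G v) (val G)) (markCount G) ⟩
    sumFin (λ v → 2 * w G v) + sumFin (val G) + n
      ≡⟨ cong (λ t → t + n) (cong₂ _+_ (sumFin-scale 2 (w G)) (handshake G)) ⟩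
    2 * W + k * 2 + n ∎

  arrange₁ : ∀ a → 2 * a + (a + 2) ≡ a * 3 + 2
  arrange₁ = solve-∀
  arrange₂ : ∀ a b c → 2 * a + b * 2 + c + 2 ≡ 2 * (b + 1 + a) + c
  arrange₂ = solve-∀
  arrange₃ : ∀ a b c → 2 * (a + b) + c ≡ 2 * b + (2 * a + c)
  arrange₃ = solve-∀

contractedCount : ∀ {k} (e : Fin k) →
                  sumFin (λ d → χ (contracted? (λ (_ : Fin 1) → e) d)) + 1 ≡ k
contractedCount {k} e = begin
  sumFin c + 1                        ≡⟨ cong (sumFin c +_) (sumFin-δ e) ⟨
  sumFin c + sumFin (λ d → χ (e ≟ d)) ≡⟨ sumFin-+ c (λ d → χ (e ≟ d)) ⟨
  sumFin (λ d → c d + χ (e ≟ d))      ≡⟨ sumFin-cong complementary ⟩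
  sumFin {k} (λ _ → 1)                ≡⟨ sumFin-const k 1 ⟩
  k * 1                               ≡⟨ *-identityʳ k ⟩
  k                                   ∎
  where
  open ≡-Reasoning
  c : Fin k → ℕ
  c d = χ (contracted? (λ (_ : Fin 1) → e) d)
  complementary : ∀ d → c d + χ (e ≟ d) ≡ 1
  complementary d = byCases (e ≟ d)
    where
    byCases : (e≟d : Dec (e ≡ d)) → c d + χ e≟d ≡ 1
    byCases (yes e≡d) = cong (_+ 1) (χ-no (λ hit → hit (zero , e≡d)) (contracted? _ d))
    byCases (no e≢d)  = trans (+-identityʳ (c d)) (χ-yes (λ (_ , e≡d) → e≢d e≡d) (contracted? _ d))

sumFin-singleton : ∀ {m} (x₀ : Fin m) → (∀ y → y ≡ x₀) → (f : Fin m → ℕ) → sumFin f ≡ f x₀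
sumFin-singleton {suc zero}    zero  _    f = +-identityʳ (f zero)
sumFin-singleton {suc (suc m)} _     only f with () ← trans (only zero) (sym (only (suc zero)))

IsLoop : ∀ {n} → WGraph n 1 → Set
IsLoop G = end G zero false ≡ end G zero true

module _ {h n : ℕ} (hg : 1 ≤ suc h) (h3 : 3 < 3 * suc h + n) where

  R¹ : SGraph (suc h) n 1
  R¹ = R1 (suc h) n hg h3

  -- A stable one-edge graph of genus h+1 whose edge is a loop is R¹: being
  -- connected it has a single vertex, of weight h by the genus formula.
  loop⇒≅R¹ : (Y : SGraph (suc h) n 1) → IsLoop (graph Y) → Y ≅ R¹
  loop⇒≅R¹ Y loop = record
    { σ      = mk↔ₛ′ (λ _ → zero) (λ _ → x₀) (λ { zero → refl }) (λ y → sym (onlyVertex y))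
    ; w-pres = λ x → trans (sym weight) (cong (w G) (sym (onlyVertex x)))
    ; m-pres = λ j → refl
    ; e-pres = λ { zero → inj₁ (λ b → refl) }
    }
    where
    G : WGraph n 1
    G = graph Y
    x₀ : Fin (nv G)
    x₀ = end G zero false

    atX₀ : ∀ b → end G zero b ≡ x₀
    atX₀ false = refl
    atX₀ true  = sym loop

    walkStays : ∀ {x y} → x ≡ x₀ → Reach (end G) (λ _ → ⊤) x y → y ≡ x₀
    walkStays x≡x₀ here                = x≡x₀
    walkStays x≡x₀ (step zero b _ _ r) = walkStays (atX₀ (not b)) r

    onlyVertex : ∀ y → y ≡ x₀
    onlyVertex y = walkStays refl (proj₂ (connected Y) x₀ y)

    oneVertex : nv G ≡ 1
    oneVertex = trans (sym (trans (sumFin-const (nv G) 1) (*-identityʳ (nv G))))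
                      (sumFin-singleton x₀ onlyVertex (λ _ → 1))

    weight : w G x₀ ≡ h
    weight = +-cancelˡ-≡ 2 (w G x₀) h (begin
      2 + w G x₀           ≡⟨ cong (2 +_) (sumFin-singleton x₀ onlyVertex (w G)) ⟨
      1 + 1 + sumFin (w G) ≡⟨ genus Y ⟩
      suc h + nv G         ≡⟨ cong (suc h +_) oneVertex ⟩
      suc h + 1            ≡⟨ +-comm (suc h) 1 ⟩
      2 + h                ∎)
      where open ≡-Reasoning

  -- Conversely a graph isomorphic to R¹ has a loop, as isomorphisms send
  -- the two half-edges of an edge to the two half-edges of its image.
  ≅R¹⇒loop : (Y : SGraph (suc h) n 1) → R¹ ≅ Y → IsLoop (graph Y)
  ≅R¹⇒loop Y iso with _≅_.e-pres iso zero
  ... | inj₁ same = trans (same false) (sym (same true))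
  ... | inj₂ swap = trans (swap false) (sym (swap true))

  contractOnto : ∀ {k} (X : SGraph (suc h) n k) (e : Fin k) →
                 (∀ x y → Avoiding (end (graph X)) e x y) →
                 IsContraction (λ (_ : Fin 1) → e) X R¹
  contractOnto {k} X e connWithout = record
    { π        = λ _ → zero
    ; π-surj   = λ { zero → fromℕ< (proj₁ (connected X)) , refl }
    ; π-edges  = λ i b → refl
    ; π-contr  = λ _ _ → refl
    ; π-fibres = λ x y _ →
        reach-mono (λ d d≢e (_ , e≡d) → d≢e (sym e≡d)) (connWithout x y)
    ; π-marks  = λ j → refl
    ; π-weight = λ { zero → weights }
    }
    where
    G : WGraph n k
    G = graph X
    V W : ℕ
    V = nv G
    W = sumFin (w G)
    c : Fin k → ℕ
    c d = χ (contracted? (λ (_ : Fin 1) → e) d)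

    genus′ : W + k ≡ h + V
    genus′ = suc-injective (trans (shift k W) (genus X))
      where
      shift : ∀ a b → suc (b + a) ≡ a + 1 + b
      shift = solve-∀

    weights : h + sumFin {V} (λ _ → 1)
              ≡ sumFin (λ x → 1 * w G x) + sumFin (λ d → c d * 1) + 1
    weights = begin
      h + sumFin {V} (λ _ → 1)   ≡⟨ cong (h +_) (trans (sumFin-const V 1) (*-identityʳ V)) ⟩
      h + V                      ≡⟨ genus′ ⟨
      W + k                      ≡⟨ cong (W +_) (contractedCount e) ⟨
      W + (sumFin c + 1)         ≡⟨ +-assoc W (sumFin c) 1 ⟨
      W + sumFin c + 1           ≡⟨ cong (λ t → t + 1) (cong₂ _+_
                                      (sumFin-cong (λ x → sym (*-identityˡ (w G x))))
                                      (sumFin-cong (λ d → sym (*-identityʳ (c d))))) ⟩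
      sumFin (λ x → 1 * w G x) + sumFin (λ d → c d * 1) + 1 ∎
      where open ≡-Reasoning

next : ∀ {M} → Fin (suc M) → Fin (suc M)
next {zero}  zero    = zero
next {suc M} zero    = suc zero
next {suc M} (suc i) = afterSuc (next i)
  where
  -- suc i is last exactly when i is.
  afterSuc : Fin (suc M) → Fin (suc (suc M))
  afterSuc zero    = zero
  afterSuc (suc j) = suc (suc j)

next-inject₁ : ∀ {M} (j : Fin M) → next (inject₁ j) ≡ suc j
next-inject₁ {suc M} zero    = refl
next-inject₁ {suc M} (suc j) rewrite next-inject₁ j = refl

next-last : ∀ M → next (fromℕ M) ≡ zero
next-last zero    = refl
next-last (suc M) rewrite next-last M = refl

prev : ∀ {M} → Fin (suc M) → Fin (suc M)
prev {M} zero = fromℕ M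
prev (suc j)  = inject₁ j

next-prev : ∀ {M} (v : Fin (suc M)) → next (prev v) ≡ v
next-prev {M} zero = next-last M
next-prev (suc j)  = next-inject₁ j

inject₁<suc : ∀ {M} (i : Fin M) → inject₁ i F.< suc i
inject₁<suc i = s≤s (≤-reflexive (toℕ-inject₁ i))

-- The necklace: a cycle on the vertices Fin (suc M), whose edge cyc i joins
-- i to next i, together with h loops lp t at the vertices lv t, and markings
-- at the vertices mv j.  When every vertex carries a marking or a loop it is
-- a stable graph of genus h + 1 with suc M + h edges, none of which
-- separates it.
module Necklace {n h M : ℕ} (mv : Fin n → Fin (suc M)) (lv : Fin h → Fin (suc M))
  (decorated : ∀ v → (Σ (Fin n) λ j → mv j ≡ v) ⊎ (Σ (Fin h) λ t → lv t ≡ v)) where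

  edges : ℕ
  edges = suc M + h

  cycEnd : Fin (suc M) → Bool → Fin (suc M)
  cycEnd i false = i
  cycEnd i true  = next i

  endK : Fin edges → Bool → Fin (suc M)
  endK e b = [ (λ i → cycEnd i b) , lv ]′ (splitAt (suc M) e)

  cyc : Fin (suc M) → Fin edges
  cyc i = i ↑ˡ h

  lp : Fin h → Fin edges
  lp t = suc M ↑ʳ t

  cyc-ends : ∀ i b → endK (cyc i) b ≡ cycEnd i b
  cyc-ends i b rewrite splitAt-↑ˡ (suc M) i h = refl

  lp-ends : ∀ t b → endK (lp t) b ≡ lv t
  lp-ends t b rewrite splitAt-↑ʳ (suc M) h t = refl

  cyc-injective : ∀ {i j} → cyc i ≡ cyc j → i ≡ j
  cyc-injective = ↑ˡ-injective h _ _

  cyc≢lp : ∀ i t → ¬ cyc i ≡ lp t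
  cyc≢lp i t same with () ←
    trans (sym (splitAt-↑ˡ (suc M) i h))
          (trans (cong (splitAt (suc M)) same) (splitAt-↑ʳ (suc M) h t))

  edgeKind : ∀ e → (Σ (Fin (suc M)) λ i → cyc i ≡ e) ⊎ (Σ (Fin h) λ t → lp t ≡ e)
  edgeKind e with splitAt (suc M) e in split
  ... | inj₁ i = inj₁ (i , splitAt⁻¹-↑ˡ split)
  ... | inj₂ t = inj₂ (t , splitAt⁻¹-↑ʳ split)

  walkDown : ∀ {P} x → (∀ i → inject₁ i F.< x → P (cyc (inject₁ i))) → Reach endK P x zero
  walkDown {P} = <-weakInduction Down (λ _ → here) climb
    where
    Down : Fin (suc M) → Set
    Down x = (∀ i → inject₁ i F.< x → P (cyc (inject₁ i))) → Reach endK P x zero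
    climb : ∀ i → Down (inject₁ i) → Down (suc i)
    climb i down allowed =
      cross (cyc (inject₁ i)) true (allowed i (inject₁<suc i))
        (trans (cyc-ends (inject₁ i) true) (next-inject₁ i)) (cyc-ends (inject₁ i) false)
        (down (λ i′ i′<i → allowed i′ (FP.<-trans i′<i (inject₁<suc i))))

  walkUp : ∀ {P} x → (∀ i → x F.≤ inject₁ i → P (cyc (inject₁ i))) → Reach endK P x (fromℕ M)
  walkUp {P} = >-weakInduction Up (λ _ → here) descend
    where
    Up : Fin (suc M) → Set
    Up x = (∀ i → x F.≤ inject₁ i → P (cyc (inject₁ i))) → Reach endK P x (fromℕ M)
    descend : ∀ i → Up (suc i) → Up (inject₁ i)
    descend i up allowed =
      cross (cyc (inject₁ i)) false (allowed i ≤-refl)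
        (cyc-ends (inject₁ i) false) (trans (cyc-ends (inject₁ i) true) (next-inject₁ i))
        (up (λ i′ i<i′ → allowed i′ (≤-trans (<⇒≤ (inject₁<suc i)) i<i′)))

  -- Without the edge e every vertex x still reaches 0: walk down, unless e is
  -- the cycle edge cyc c with c < x; then walk up and across the closing edge.
  toZero : ∀ e x → Avoiding endK e x zero
  toZero e x with edgeKind e
  ... | inj₂ (t , refl) = walkDown x (λ i _ same → cyc≢lp (inject₁ i) t same)
  ... | inj₁ (c , refl) with x F.≤? c
  ...   | yes x≤c = walkDown x λ i i<x same →
          <-irrefl (cong toℕ (cyc-injective same)) (≤-trans i<x x≤c)
  ...   | no x≰c  = reach-trans
          (walkUp x λ i x≤i same → x≰c (subst (x F.≤_) (cyc-injective same) x≤i))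
          (cross (cyc (fromℕ M)) false
            (λ same → x≰c (subst (x F.≤_) (cyc-injective same) (≤fromℕ x)))
            (cyc-ends (fromℕ M) false) (trans (cyc-ends (fromℕ M) true) (next-last M)) here)

  twoEdgeConnected : ∀ e x y → Avoiding endK e x y
  twoEdgeConnected e x y = reach-trans (toZero e x) (reach-rev (toZero e y))

  G : WGraph n edges
  G = record { nv = suc M ; w = λ _ → 0 ; m = mv ; end = endK }

  incidence : Fin (suc M) → Fin edges → ℕ
  incidence v e = χ (endK e false ≟ v) + χ (endK e true ≟ v)

  incident : ∀ {v} e b → endK e b ≡ v → 1 ≤ incidence v e
  incident {v} e false atV =
    ≤-trans (≤-reflexive (sym (χ-yes atV (endK e false ≟ v)))) (m≤m+n _ _)
  incident {v} e true  atV =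
    ≤-trans (≤-reflexive (sym (χ-yes atV (endK e true ≟ v)))) (m≤n+m _ _)

  loopIncidence : ∀ {v} e → endK e false ≡ v → endK e true ≡ v → incidence v e ≡ 2
  loopIncidence {v} e p q = cong₂ _+_ (χ-yes p (endK e false ≟ v)) (χ-yes q (endK e true ≟ v))

  -- The cycle alone gives every vertex valence at least 2: the edge leaving
  -- v and the edge arriving at v are distinct, unless the cycle is one loop.
  cycleValence : ∀ v → 2 ≤ val G v
  cycleValence v with next v ≟ v
  ... | yes selfLoop = subst (_≤ val G v)
          (loopIncidence (cyc v) (cyc-ends v false) (trans (cyc-ends v true) selfLoop))
          (term≤sumFin (incidence v) (cyc v))
  ... | no ¬selfLoop = ≤-trans
          (+-mono-≤ (incident (cyc v) false (cyc-ends v false))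
                    (incident (cyc (prev v)) true (trans (cyc-ends (prev v) true) (next-prev v))))
          (terms≤sumFin (incidence v) (cyc v) (cyc (prev v))
            (λ same → ¬selfLoop (trans (cong next (cyc-injective same)) (next-prev v))))

  -- A marked vertex has valence ≥ 2 and a marking; a vertex with a loop
  -- has valence ≥ 3.
  stableK : Stable G
  stableK v with decorated v
  ... | inj₁ (j , marked) = +-mono-≤ (cycleValence v)
          (≤-trans (≤-reflexive (sym (χ-yes marked (mv j ≟ v))))
                   (term≤sumFin (λ j′ → χ (mv j′ ≟ v)) j))
  ... | inj₂ (t , looped) = ≤-trans
          (≤-trans (+-mono-≤ (≤-reflexive (sym (loopIncidence (lp t) (trans (lp-ends t false) looped)
                                                              (trans (lp-ends t true) looped))))
                             (incident (cyc v) false (cyc-ends v false)))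
                   (terms≤sumFin (incidence v) (lp t) (cyc v) (λ same → cyc≢lp v t (sym same))))
          (m≤m+n _ _)

  -- b¹ = (suc M + h) - (suc M) + 1 = h + 1, all weights being 0.
  genusK : HasGenus G (suc h)
  genusK = trans (cong (edges + 1 +_) (trans (sumFin-const (suc M) 0) (*-zeroʳ (suc M))))
                 (arrange M h)
    where
    arrange : ∀ a b → suc a + b + 1 + 0 ≡ suc b + suc a
    arrange = solve-∀

  K : SGraph (suc h) n edges
  K = record
    { graph     = G
    ; connected = s≤s z≤n , (λ x y → reach-mono (λ _ _ → tt) (twoEdgeConnected (cyc zero) x y))
    ; genus     = genusK
    ; stable    = stableK
    }

module Decoration {n h M : ℕ} (size : n + h ≡ suc M) where

  mark : Fin n → Fin (suc M)
  mark j = cast size (j ↑ˡ h)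

  loopAt : Fin h → Fin (suc M)
  loopAt t = cast size (n ↑ʳ t)

  castBack : ∀ v → cast size (cast (sym size) v) ≡ v
  castBack = cast-involutive size (sym size)

  decorated : ∀ v → (Σ (Fin n) λ j → mark j ≡ v) ⊎ (Σ (Fin h) λ t → loopAt t ≡ v)
  decorated v with splitAt n (cast (sym size) v) in split
  ... | inj₁ j = inj₁ (j , trans (cong (cast size) (splitAt⁻¹-↑ˡ split)) (castBack v))
  ... | inj₂ t = inj₂ (t , trans (cong (cast size) (splitAt⁻¹-↑ʳ split)) (castBack v))

-- For g = h + 1 the condition 3g - 3 + n > 0 says n + h ≥ 1.
necklaceSize : ∀ h n → 3 < 3 * suc h + n → Σ ℕ λ M → n + h ≡ suc M
necklaceSize h       (suc n) _ = n + h , refl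
necklaceSize (suc h) zero    _ = h , refl
necklaceSize zero    zero    (s≤s (s≤s (s≤s ())))

module _ {h n : ℕ} (hg : 1 ≤ suc h) (h3 : 3 < 3 * suc h + n) (Φ : NatAut (suc h) n) where

  -- If the ends of an edge e of Φ(G) are
  -- joined avoiding e, then contracting all edges but e gives R¹ both in G
  -- and in Φ(G), so by naturality R¹ ≅ Φ(R¹), whose edge is thus a loop.
  nonBridge⇒loop : ∀ {k} (G : SGraph (suc h) n k) →
    (∀ e x y → Avoiding (end (graph G)) e x y) →
    ∀ e → Avoiding (end (graph (NatAut.Φ Φ k G))) e
                   (end (graph (NatAut.Φ Φ k G)) e false) (end (graph (NatAut.Φ Φ k G)) e true) →
    IsLoop (graph (NatAut.Φ Φ 1 (R¹ hg h3)))
  nonBridge⇒loop {k} G noSeparating e joined =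
    ≅R¹⇒loop hg h3 (NatAut.Φ Φ 1 (R¹ hg h3))
      (NatAut.natural Φ 1 k (λ _ → e) (λ { {zero} {zero} _ → refl }) G (R¹ hg h3) (R¹ hg h3)
        (contractOnto hg h3 G e (noSeparating e))
        (contractOnto hg h3 X e (λ x y → reroute e joined (proj₂ (connected X) x y))))
    where
    X : SGraph (suc h) n k
    X = NatAut.Φ Φ k G

  -- The edge of Φ(R¹) is a loop.  Otherwise every edge of X = Φ(necklace) is
  -- a bridge, so X has more than n + 2h vertices, while a stable graph of
  -- genus h + 1 has at most 2h + n of them.
  ΦR¹-loop : IsLoop (graph (NatAut.Φ Φ 1 (R¹ hg h3)))
  ΦR¹-loop = decidable-stable (_ ≟ _) (¬¬loop (proj₂ (necklaceSize h n h3)))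
    where
    ¬¬loop : ∀ {M} → n + h ≡ suc M → ¬ ¬ IsLoop (graph (NatAut.Φ Φ 1 (R¹ hg h3)))
    ¬¬loop {M} size notLoop = <⇒≱ edges<vertices vertices≤edges
      where
      open Decoration {n} {h} size
      open Necklace mark loopAt decorated using (edges; K; twoEdgeConnected)
      X : SGraph (suc h) n edges
      X = NatAut.Φ Φ edges K

      edges<vertices : edges < nv (graph X)
      edges<vertices = allBridges⇒edges<vertices (end (graph X)) (proj₂ (connected X))
        (fromℕ< (proj₁ (connected X)))
        (λ e joined → notLoop (nonBridge⇒loop K twoEdgeConnected e joined))

      vertices≤edges : nv (graph X) ≤ edges
      vertices≤edges = +-cancelʳ-≤ 2 (nv (graph X)) edges (begin
        nv (graph X) + 2  ≤⟨ vertexBound X ⟩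
        2 * suc h + n     ≡⟨ arrange h n ⟩
        n + h + h + 2     ≡⟨ cong (λ t → t + h + 2) size ⟩
        edges + 2         ∎)
        where
        open ≤-Reasoning
        arrange : ∀ a b → 2 * suc a + b ≡ b + a + a + 2
        arrange = solve-∀

lemma3p5 : (g n : ℕ) (hg : 1 ≤ g) (h : 3 < 3 * g + n) (Φ : NatAut g n) →
           NatAut.Φ Φ 1 (R1 g n hg h) ≅ R1 g n hg h
lemma3p5 zero    n () h  Φ
lemma3p5 (suc h) n hg h3 Φ = loop⇒≅R¹ hg h3 (NatAut.Φ Φ 1 (R¹ hg h3)) (ΦR¹-loop hg h3 Φ)
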